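{- Let $G$ be a connected undirected simple graph, $k$ a positive integer, and $\mathit{In}\neq\emptyset$ a set of vertices of $G$ such that $G[\mathit{In}]$ is connected. Then the procedure LIN-ENUM-V$(G,\mathit{In},k)$ outputs all $k$-graphlets of $G$ that contain $\mathit{In}$.
   Context: A $k$-graphlet of $G$ is a connected subgraph induced by a set of exactly $k$ vertices (identified with its vertex set); it contains $\mathit{In}$ if its vertex set contains $\mathit{In}$. For a vertex set $U$, $N(U)=\bigcup_{u\in U}N(u)\setminus U$ is its open neighbourhood. A vertex $v$ is mandatory for $G,\mathit{In},k$ if the connected component of $G-v$ containing the vertices of $\mathit{In}$ has at most $k-1$ vertices. Procedure LIN-ENUM-V$(G,\mathit{In},k)$: (1) if $|\mathit{In}|=k$, output $\mathit{In}$ and return; (2) while $N(\mathit{In})$ contains a mandatory vertex $u$ (for $G,\mathit{In},k$): set $\mathit{In}\gets\mathit{In}\cup\{u\}$, and if now $|\mathit{In}|=k$, output $\mathit{In}$ and return; (3) let $v$ be a vertex of $N(\mathit{In})$ (necessarily non-mandatory); call LIN-ENUM-V$(G,\mathit{In}\cup\{v\},k)$ and then LIN-ENUM-V$(G-v,\mathit{In},k)$. -}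

module Defs where

open import Data.Nat using (ℕ; _≤_; _∸_)
open import Data.Bool using (Bool; true; false)
open import Data.Fin using (Fin)
open import Data.Fin.Subset using (Subset; _∈_; _∉_; _⊆_; _∪_; _-_; ∣_∣; ⁅_⁆; ⊤)
open import Data.List using (List; []; [_]; _++_)
open import Data.Product using (Σ; _×_; ∃)
open import Relation.Binary.PropositionalEquality using (_≡_; _≢_)
open import Relation.Nullary using (¬_)

record Graph (n : ℕ) : Set where
  field
    E     : Fin n → Fin n → Bool
    sym   : ∀ x y → E x y ≡ E y x
    irref : ∀ x → E x x ≡ false

open Graph public

Adj : ∀ {n} → Graph n → Fin n → Fin n → Set
Adj G x y = E G x y ≡ true

data Reach {n} (G : Graph n) (W S : Subset n) : Fin n → Set where
  base : ∀ {x} → x ∈ S → x ∈ W → Reach G W S x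
  step : ∀ {x y} → Reach G W S y → Adj G y x → x ∈ W → Reach G W S x

ConnectedOn : ∀ {n} → Graph n → Subset n → Set
ConnectedOn G W = ∀ x y → x ∈ W → y ∈ W → Reach G W ⁅ x ⁆ y

Connected : ∀ {n} → Graph n → Set
Connected G = ConnectedOn G ⊤

Graphlet : ∀ {n} → Graph n → ℕ → Subset n → Set
Graphlet G k S = (∣ S ∣ ≡ k) × ConnectedOn G S

InN : ∀ {n} → Graph n → (V In : Subset n) → Fin n → Set
InN G V In u = u ∈ V × u ∉ In × Σ (Fin _) (λ w → w ∈ In × Adj G w u)

-- Mandatory vertex for G[V], In, k: the connected component of G[V] - v
-- containing In has at most k-1 vertices (i.e. it is contained in a
-- vertex set of size at most k-1).
Mandatory : ∀ {n} → Graph n → (V In : Subset n) → ℕ → Fin n → Set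
Mandatory G V In k v =
  Σ (Subset _) (λ C → (∣ C ∣ ≤ k ∸ 1) × (∀ x → Reach G (V - v) In x → x ∈ C))

-- Run G V In k L : some execution of LIN-ENUM-V(G[V], In, k) (for any
-- admissible choices of u and v) terminates, producing the output list L
-- (in order).  The while-loop of step (2) is unrolled as a tail call.
data Run {n} (G : Graph n) (k : ℕ) : (V In : Subset n) → List (Subset n) → Set where
  done   : ∀ {V In} → ∣ In ∣ ≡ k → Run G k V In [ In ]
  mand   : ∀ {V In L} u → ∣ In ∣ ≢ k → InN G V In u → Mandatory G V In k u →
           Run G k V (In ∪ ⁅ u ⁆) L → Run G k V In L
  branch : ∀ {V In L₁ L₂} v → ∣ In ∣ ≢ k → InN G V In v →
           (∀ u → InN G V In u → ¬ Mandatory G V In k u) →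
           Run G k V (In ∪ ⁅ v ⁆) L₁ → Run G k (V - v) In L₂ →
           Run G k V In (L₁ ++ L₂)
  stuck  : ∀ {V In} → ∣ In ∣ ≢ k → (∀ u → ¬ InN G V In u) → Run G k V In []

-- Every step of LIN-ENUM-V preserves the set of k-graphlets S with In ⊆ S ⊆ V, where V is the
-- current vertex set: a mandatory vertex u lies in every such S (otherwise S would sit inside
-- the component of G[V] - u containing In, which has fewer than k vertices), and a branch on v
-- splits these graphlets into those containing v and those avoiding it.  When |In| = k the only
-- one is In itself; when In has no neighbours left, none exists, because a path inside S from
-- In to a vertex outside In would cross N(In).  Termination follows from the measure
-- |V| + (n - |In|), which every recursive call decreases.
module Submission where

open import Defs hiding (sym)
open import Data.Nat using (ℕ; _≤_)
open import Data.Fin.Subset using (Subset; _⊆_; Nonempty; ⊤)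
open import Data.List using (List)
open import Data.List.Relation.Unary.Any using (Any)
open import Data.Product using (Σ; _×_)
open import Function.Bundles using (_⇔_)
open import Relation.Binary.PropositionalEquality using (_≡_)

open import Data.Nat using (suc; _<_; _+_; _∸_; _≟_; _≤?_; z≤n; s≤s)
open import Data.Nat.Properties using (≤-refl; ≤-reflexive; ≤-pred; <-≤-trans; <⇒≱; +-monoʳ-<; +-monoˡ-<; ∸-monoʳ-<)
open import Data.Bool using (true) renaming (_≟_ to _≟ᵇ_)
open import Data.Fin using () renaming (_≟_ to _≟ᶠ_)
open import Data.Fin.Properties using (any?; all?)
open import Data.Fin.Subset using (_∈_; _∉_; _∪_; _─_; _-_; inside; ∣_∣; ⁅_⁆)
open import Data.Fin.Subset.Properties
  using (_∈?_; ∈⊤; ⊆-antisym; x∈⁅x⁆; x∈⁅y⁆⇒x≡y; p⊆p∪q; x∈p∪q⁺; x∈p∪q⁻; p─q⊆p;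
         x∈p∧x≢y⇒x∈p-y; ∣p∣≤n; p⊆q⇒∣p∣≤∣q∣; p⊂q⇒∣p∣<∣q∣; x∈p⇒∣p-x∣<∣p∣; anySubset?)
open import Data.List using ([_]; _++_)
open import Data.Vec using (_∷_; here; there)
open import Data.List.Relation.Unary.Any using (here)
open import Data.List.Relation.Unary.Any.Properties using (++↔)
open import Data.Product using (_,_; proj₁; ∃-syntax)
open import Data.Sum using (_⊎_; inj₁; inj₂; [_,_]′)
open import Data.Sum.Function.Propositional using (_⊎-⇔_)
open import Data.Empty using (⊥-elim)
open import Relation.Nullary using (¬_; Dec; yes; no)
open import Relation.Nullary.Decidable using (_×-dec_; _→-dec_; ¬?)
open import Relation.Binary.PropositionalEquality using (_≢_; refl; sym; trans; subst; cong)
open import Function.Base using (_∘_)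
open import Function.Bundles using (mk⇔; Equivalence)
open import Function.Construct.Composition using (_⇔-∘_)
open import Function.Construct.Symmetry using (⇔-sym)
open import Function.Related.Propositional using (equivalence; module EquationalReasoning)

x∈p─q⇒x∉q : ∀ {n} {p q : Subset n} {x} → x ∈ p ─ q → x ∉ q
x∈p─q⇒x∉q {p = _ ∷ p} {_ ∷ q} (there x∈p─q) (there x∈q) = x∈p─q⇒x∉q x∈p─q x∈q
x∈p─q⇒x∉q {p = _ ∷ _} {inside ∷ _} () here

module _ {n : ℕ} where

  x∉p-x : ∀ {p : Subset n} {x} → x ∉ p - x
  x∉p-x {x = x} x∈p-x = x∈p─q⇒x∉q x∈p-x (x∈⁅x⁆ x)

  x∈p⇒⁅x⁆⊆p : ∀ {p : Subset n} {x} → x ∈ p → ⁅ x ⁆ ⊆ p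
  x∈p⇒⁅x⁆⊆p {p} {x} x∈p y∈⁅x⁆ = subst (_∈ p) (sym (x∈⁅y⁆⇒x≡y x y∈⁅x⁆)) x∈p

  p∪⁅x⁆⊆q⇔p⊆q∧x∈q : ∀ {p q : Subset n} {x} → p ∪ ⁅ x ⁆ ⊆ q ⇔ (p ⊆ q × x ∈ q)
  p∪⁅x⁆⊆q⇔p⊆q∧x∈q {p} {q} {x} = mk⇔ split join
    where
    split : p ∪ ⁅ x ⁆ ⊆ q → p ⊆ q × x ∈ q
    split p∪x⊆q = (λ y∈p → p∪x⊆q (p⊆p∪q ⁅ x ⁆ y∈p)) , p∪x⊆q (x∈p∪q⁺ (inj₂ (x∈⁅x⁆ x)))
    join : p ⊆ q × x ∈ q → p ∪ ⁅ x ⁆ ⊆ q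
    join (p⊆q , x∈q) y∈p∪x = [ p⊆q , x∈p⇒⁅x⁆⊆p x∈q ]′ (x∈p∪q⁻ p ⁅ x ⁆ y∈p∪x)

  p⊆q-x⇔p⊆q∧x∉p : ∀ {p q : Subset n} {x} → p ⊆ q - x ⇔ (p ⊆ q × x ∉ p)
  p⊆q-x⇔p⊆q∧x∉p {p} {q} {x} = mk⇔ split join
    where
    split : p ⊆ q - x → p ⊆ q × x ∉ p
    split p⊆q-x = p─q⊆p q ⁅ x ⁆ ∘ p⊆q-x , x∉p-x ∘ p⊆q-x
    join : p ⊆ q × x ∉ p → p ⊆ q - x
    join (p⊆q , x∉p) {y} y∈p = x∈p∧x≢y⇒x∈p-y (p⊆q y∈p) λ { refl → x∉p y∈p }

  p⊆q∧∣q∣≤∣p∣⇒p≡q : ∀ {p q : Subset n} → p ⊆ q → ∣ q ∣ ≤ ∣ p ∣ → p ≡ q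
  p⊆q∧∣q∣≤∣p∣⇒p≡q {p} {q} p⊆q ∣q∣≤∣p∣ = ⊆-antisym p⊆q q⊆p
    where
    q⊆p : q ⊆ p
    q⊆p {x} x∈q with x ∈? p
    ... | yes x∈p = x∈p
    ... | no x∉p = ⊥-elim (<⇒≱ (p⊂q⇒∣p∣<∣q∣ (p⊆q , x , x∈q , x∉p)) ∣q∣≤∣p∣)

  x∉p⇒∣p∣<∣p∪⁅x⁆∣ : ∀ {p : Subset n} {x} → x ∉ p → ∣ p ∣ < ∣ p ∪ ⁅ x ⁆ ∣
  x∉p⇒∣p∣<∣p∪⁅x⁆∣ {p} {x} x∉p = p⊂q⇒∣p∣<∣q∣ (p⊆p∪q ⁅ x ⁆ , x , x∈p∪q⁺ (inj₂ (x∈⁅x⁆ x)) , x∉p)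

module _ {n : ℕ} (G : Graph n) where

  Adj-sym : ∀ {x y} → Adj G x y → Adj G y x
  Adj-sym {x} {y} xy = trans (Graph.sym G y x) xy

  Adj? : ∀ x y → Dec (Adj G x y)
  Adj? x y = E G x y ≟ᵇ true

  Reach⇒∈ : ∀ {W S x} → Reach G W S x → x ∈ W
  Reach⇒∈ (base _ x∈W) = x∈W
  Reach⇒∈ (step _ _ x∈W) = x∈W

  Reach-mono : ∀ {W W′ S S′ x} → W ⊆ W′ → S ⊆ S′ → Reach G W S x → Reach G W′ S′ x
  Reach-mono W⊆W′ S⊆S′ (base x∈S x∈W) = base (S⊆S′ x∈S) (W⊆W′ x∈W)
  Reach-mono W⊆W′ S⊆S′ (step r yx x∈W) = step (Reach-mono W⊆W′ S⊆S′ r) yx (W⊆W′ x∈W)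

  Reach-trans : ∀ {W S T x} → (∀ {s} → s ∈ S → Reach G W T s) → Reach G W S x → Reach G W T x
  Reach-trans S↝T (base x∈S _) = S↝T x∈S
  Reach-trans S↝T (step r yx x∈W) = step (Reach-trans S↝T r) yx x∈W

  -- Cut a walk at its first visit to z.
  Reach-avoiding⊎entering : ∀ {W S y} z → Reach G W S y →
    Reach G (W - z) S y ⊎ (z ∈ S ⊎ ∃[ x ] Reach G (W - z) S x × Adj G x z)
  Reach-avoiding⊎entering {y = y} z (base y∈S y∈W) with y ≟ᶠ z
  ... | yes refl = inj₂ (inj₁ y∈S)
  ... | no y≢z = inj₁ (base y∈S (x∈p∧x≢y⇒x∈p-y y∈W y≢z))
  Reach-avoiding⊎entering {y = y} z (step {y = x} r xy y∈W) with Reach-avoiding⊎entering z r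
  ... | inj₂ entering = inj₂ entering
  ... | inj₁ r′ with y ≟ᶠ z
  ...   | yes refl = inj₂ (inj₂ (x , r′ , xy))
  ...   | no y≢z = inj₁ (step r′ xy (x∈p∧x≢y⇒x∈p-y y∈W y≢z))

  Reach-last-step : ∀ {W S y} → Reach G W S y → y ∉ S → ∃[ x ] Reach G (W - y) S x × Adj G x y
  Reach-last-step {y = y} r y∉S with Reach-avoiding⊎entering y r
  ... | inj₁ r′ = ⊥-elim (x∉p-x (Reach⇒∈ r′))
  ... | inj₂ (inj₁ y∈S) = ⊥-elim (y∉S y∈S)
  ... | inj₂ (inj₂ last) = last

  Reach?-within : ∀ fuel W S → ∣ W ∣ < fuel → ∀ y → Dec (Reach G W S y)
  Reach?-within (suc fuel) W S ∣W∣<fuel y with y ∈? W | y ∈? S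
  ... | no y∉W | _ = no (y∉W ∘ Reach⇒∈)
  ... | yes y∈W | yes y∈S = yes (base y∈S y∈W)
  ... | yes y∈W | no y∉S
      with any? (λ x → Reach?-within fuel (W - y) S ∣W-y∣<fuel x ×-dec Adj? x y)
    where
    ∣W-y∣<fuel : ∣ W - y ∣ < fuel
    ∣W-y∣<fuel = <-≤-trans (x∈p⇒∣p-x∣<∣p∣ y∈W) (≤-pred ∣W∣<fuel)
  ...   | yes (x , r , xy) = yes (step (Reach-mono (p─q⊆p W ⁅ y ⁆) (λ s → s) r) xy y∈W)
  ...   | no ¬last = no (λ r → ¬last (Reach-last-step r y∉S))

  Reach? : ∀ W S y → Dec (Reach G W S y)
  Reach? W S = Reach?-within (suc n) W S (s≤s (∣p∣≤n W))

  ConnectedOn-∪⁅⁆ : ∀ {In w u} → ConnectedOn G In → w ∈ In → Adj G w u → ConnectedOn G (In ∪ ⁅ u ⁆)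
  ConnectedOn-∪⁅⁆ {In} {w} {u} conn w∈In wu x y x∈ y∈ =
    Reach-trans (λ s∈⁅w⁆ → subst (Reach G In′ ⁅ x ⁆) (sym (x∈⁅y⁆⇒x≡y w s∈⁅w⁆)) (to-w x∈)) (from-w y∈)
    where
    In′ : Subset n
    In′ = In ∪ ⁅ u ⁆
    In⊆In′ : In ⊆ In′
    In⊆In′ = p⊆p∪q ⁅ u ⁆
    u∈In′ : u ∈ In′
    u∈In′ = x∈p∪q⁺ (inj₂ (x∈⁅x⁆ u))
    from-w : ∀ {z} → z ∈ In′ → Reach G In′ ⁅ w ⁆ z
    from-w {z} z∈ with x∈p∪q⁻ In ⁅ u ⁆ z∈
    ... | inj₁ z∈In = Reach-mono In⊆In′ (λ s → s) (conn w z w∈In z∈In)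
    ... | inj₂ z∈⁅u⁆ rewrite x∈⁅y⁆⇒x≡y u z∈⁅u⁆ = step (base (x∈⁅x⁆ w) (In⊆In′ w∈In)) wu u∈In′
    to-w : ∀ {z} → z ∈ In′ → Reach G In′ ⁅ z ⁆ w
    to-w {z} z∈ with x∈p∪q⁻ In ⁅ u ⁆ z∈
    ... | inj₁ z∈In = Reach-mono In⊆In′ (λ s → s) (conn z w z∈In w∈In)
    ... | inj₂ z∈⁅u⁆ rewrite x∈⁅y⁆⇒x≡y u z∈⁅u⁆ = step (base (x∈⁅x⁆ u) u∈In′) (Adj-sym wu) (In⊆In′ w∈In)

  Reach-leaving⇒InN : ∀ {W T V In y} → Reach G W T y → T ⊆ In → W ⊆ V → y ∉ In → ∃[ u ] InN G V In u
  Reach-leaving⇒InN (base y∈T _) T⊆In _ y∉In = ⊥-elim (y∉In (T⊆In y∈T))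
  Reach-leaving⇒InN {In = In} (step {y = x} r xy y∈W) T⊆In W⊆V y∉In with x ∈? In
  ... | yes x∈In = _ , W⊆V y∈W , y∉In , x , x∈In , xy
  ... | no x∉In = Reach-leaving⇒InN r T⊆In W⊆V x∉In

  InN? : ∀ V In u → Dec (InN G V In u)
  InN? V In u = u ∈? V ×-dec ¬? (u ∈? In) ×-dec any? (λ w → w ∈? In ×-dec Adj? w u)

  Mandatory? : ∀ V In k u → Dec (Mandatory G V In k u)
  Mandatory? V In k u =
    anySubset? (λ C → ∣ C ∣ ≤? k ∸ 1 ×-dec all? (λ x → Reach? (V - u) In x →-dec x ∈? C))

  size : Subset n → Subset n → ℕ
  size V In = ∣ V ∣ + (n ∸ ∣ In ∣)

  size-In∪⁅u⁆< : ∀ V {In u} → u ∉ In → size V (In ∪ ⁅ u ⁆) < size V In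
  size-In∪⁅u⁆< V {In} {u} u∉In = +-monoʳ-< ∣ V ∣ (∸-monoʳ-< (x∉p⇒∣p∣<∣p∪⁅x⁆∣ u∉In) (∣p∣≤n (In ∪ ⁅ u ⁆)))

  size-V-v< : ∀ {V} In {v} → v ∈ V → size (V - v) In < size V In
  size-V-v< In v∈V = +-monoˡ-< (n ∸ ∣ In ∣) (x∈p⇒∣p-x∣<∣p∣ v∈V)

  Run-within : ∀ k fuel V In → size V In < fuel → ∃[ L ] Run G k V In L
  Run-within k (suc fuel) V In <fuel with ∣ In ∣ ≟ k
  ... | yes ∣In∣≡k = _ , done ∣In∣≡k
  ... | no ∣In∣≢k with any? (λ u → InN? V In u ×-dec Mandatory? V In k u)
  ...   | yes (u , u∈N@(_ , u∉In , _) , u-mand) =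
          let L , run = Run-within k fuel V (In ∪ ⁅ u ⁆) (<-≤-trans (size-In∪⁅u⁆< V u∉In) (≤-pred <fuel))
          in L , mand u ∣In∣≢k u∈N u-mand run
  ...   | no ¬mand with any? (InN? V In)
  ...     | no ¬N = _ , stuck ∣In∣≢k (λ u u∈N → ¬N (u , u∈N))
  ...     | yes (v , v∈N@(v∈V , v∉In , _)) =
            let L₁ , run₁ = Run-within k fuel V (In ∪ ⁅ v ⁆) (<-≤-trans (size-In∪⁅u⁆< V v∉In) (≤-pred <fuel))
                L₂ , run₂ = Run-within k fuel (V - v) In (<-≤-trans (size-V-v< In v∈V) (≤-pred <fuel))
            in _ , branch v ∣In∣≢k v∈N (λ u u∈N u-mand → ¬mand (u , u∈N , u-mand)) run₁ run₂

  Run-exists : ∀ k V In → ∃[ L ] Run G k V In L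
  Run-exists k V In = Run-within k (suc (size V In)) V In ≤-refl

  GraphletBetween : ℕ → (In V : Subset n) → Subset n → Set
  GraphletBetween k In V S = Graphlet G k S × In ⊆ S × S ⊆ V

  record Admissible (V In : Subset n) : Set where
    field
      In⊆V      : In ⊆ V
      nonempty  : Nonempty In
      connected : ConnectedOn G In

  Admissible-∪⁅⁆ : ∀ {V In u} → Admissible V In → InN G V In u → Admissible V (In ∪ ⁅ u ⁆)
  Admissible-∪⁅⁆ (record { In⊆V = In⊆V ; nonempty = i , i∈In ; connected = conn }) (u∈V , _ , w , w∈In , wu) =
    record
      { In⊆V      = Equivalence.from p∪⁅x⁆⊆q⇔p⊆q∧x∈q (In⊆V , u∈V)
      ; nonempty  = i , p⊆p∪q _ i∈In
      ; connected = ConnectedOn-∪⁅⁆ conn w∈In wu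
      }

  Admissible-V-v : ∀ {V In v} → Admissible V In → InN G V In v → Admissible (V - v) In
  Admissible-V-v (record { In⊆V = In⊆V ; nonempty = ne ; connected = conn }) (_ , v∉In , _) =
    record { In⊆V = Equivalence.from p⊆q-x⇔p⊆q∧x∉p (In⊆V , v∉In) ; nonempty = ne ; connected = conn }

  graphlets-done : ∀ {k V In S} → ∣ In ∣ ≡ k → Admissible V In →
    Any (S ≡_) [ In ] ⇔ GraphletBetween k In V S
  graphlets-done {k} {V} {In} {S} ∣In∣≡k adm = mk⇔ to from
    where
    to : Any (S ≡_) [ In ] → GraphletBetween k In V S
    to (here refl) = (∣In∣≡k , Admissible.connected adm) , (λ s → s) , Admissible.In⊆V adm
    from : GraphletBetween k In V S → Any (S ≡_) [ In ]
    from ((∣S∣≡k , _) , In⊆S , _) = here (sym (p⊆q∧∣q∣≤∣p∣⇒p≡q In⊆S (≤-reflexive (trans ∣S∣≡k (sym ∣In∣≡k)))))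

  Mandatory⇒∈ : ∀ {k V In S u} → 1 ≤ k → Nonempty In → Mandatory G V In k u →
    GraphletBetween k In V S → u ∈ S
  Mandatory⇒∈ {V = V} {S = S} {u} (s≤s z≤n) (i , i∈In) (C , ∣C∣≤ , C⊇comp) ((∣S∣≡k , S-conn) , In⊆S , S⊆V)
    with u ∈? S
  ... | yes u∈S = u∈S
  ... | no u∉S = ⊥-elim (<⇒≱ (subst (∣ C ∣ <_) (sym ∣S∣≡k) (s≤s ∣C∣≤)) (p⊆q⇒∣p∣≤∣q∣ S⊆C))
    where
    S⊆V-u : S ⊆ V - u
    S⊆V-u = Equivalence.from p⊆q-x⇔p⊆q∧x∉p (S⊆V , u∉S)
    S⊆C : S ⊆ C
    S⊆C {x} x∈S = C⊇comp x (Reach-mono S⊆V-u (x∈p⇒⁅x⁆⊆p i∈In) (S-conn i x (In⊆S i∈In) x∈S))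

  graphlets-mandatory : ∀ {k V In S u} → 1 ≤ k → Nonempty In → Mandatory G V In k u →
    GraphletBetween k (In ∪ ⁅ u ⁆) V S ⇔ GraphletBetween k In V S
  graphlets-mandatory 1≤k ne u-mand = mk⇔
    (λ (g , In∪u⊆S , S⊆V) → g , proj₁ (Equivalence.to p∪⁅x⁆⊆q⇔p⊆q∧x∈q In∪u⊆S) , S⊆V)
    (λ b@(g , In⊆S , S⊆V) → g , Equivalence.from p∪⁅x⁆⊆q⇔p⊆q∧x∈q (In⊆S , Mandatory⇒∈ 1≤k ne u-mand b) , S⊆V)

  graphlets-branch : ∀ {k V In S} v →
    GraphletBetween k In V S ⇔ (GraphletBetween k (In ∪ ⁅ v ⁆) V S ⊎ GraphletBetween k In (V - v) S)
  graphlets-branch {k} {V} {In} {S} v = mk⇔ to from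
    where
    to : GraphletBetween k In V S → GraphletBetween k (In ∪ ⁅ v ⁆) V S ⊎ GraphletBetween k In (V - v) S
    to (g , In⊆S , S⊆V) with v ∈? S
    ... | yes v∈S = inj₁ (g , Equivalence.from p∪⁅x⁆⊆q⇔p⊆q∧x∈q (In⊆S , v∈S) , S⊆V)
    ... | no v∉S = inj₂ (g , In⊆S , Equivalence.from p⊆q-x⇔p⊆q∧x∉p (S⊆V , v∉S))
    from : GraphletBetween k (In ∪ ⁅ v ⁆) V S ⊎ GraphletBetween k In (V - v) S → GraphletBetween k In V S
    from (inj₁ (g , In∪v⊆S , S⊆V)) = g , proj₁ (Equivalence.to p∪⁅x⁆⊆q⇔p⊆q∧x∈q In∪v⊆S) , S⊆V
    from (inj₂ (g , In⊆S , S⊆V-v)) = g , In⊆S , proj₁ (Equivalence.to p⊆q-x⇔p⊆q∧x∉p S⊆V-v)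

  no-graphlets-stuck : ∀ {k V In S} → ∣ In ∣ ≢ k → Nonempty In → (∀ u → ¬ InN G V In u) →
    ¬ GraphletBetween k In V S
  no-graphlets-stuck {In = In} {S} ∣In∣≢k (i , i∈In) no-N ((∣S∣≡k , S-conn) , In⊆S , S⊆V)
    with any? (λ x → x ∈? S ×-dec ¬? (x ∈? In))
  ... | yes (x , x∈S , x∉In) =
        let u , u∈N = Reach-leaving⇒InN (S-conn i x (In⊆S i∈In) x∈S) (x∈p⇒⁅x⁆⊆p i∈In) S⊆V x∉In
        in no-N u u∈N
  ... | no S⊈In = ∣In∣≢k (trans (cong ∣_∣ (⊆-antisym In⊆S S⊆In)) ∣S∣≡k)
    where
    S⊆In : S ⊆ In
    S⊆In {x} x∈S with x ∈? In
    ... | yes x∈In = x∈In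
    ... | no x∉In = ⊥-elim (S⊈In (x , x∈S , x∉In))

  Run⇒enumerates : ∀ {k V In L} → 1 ≤ k → Run G k V In L → Admissible V In →
    ∀ S → Any (S ≡_) L ⇔ GraphletBetween k In V S
  Run⇒enumerates 1≤k (done ∣In∣≡k) adm S = graphlets-done ∣In∣≡k adm
  Run⇒enumerates 1≤k (mand u _ u∈N u-mand run) adm S =
    graphlets-mandatory 1≤k (Admissible.nonempty adm) u-mand
      ⇔-∘ Run⇒enumerates 1≤k run (Admissible-∪⁅⁆ adm u∈N) S
  Run⇒enumerates {k} {V} {In} 1≤k (branch {L₁ = L₁} {L₂} v _ v∈N _ run₁ run₂) adm S = begin
    Any (S ≡_) (L₁ ++ L₂)                                                 ↔⟨ ++↔ ⟨
    (Any (S ≡_) L₁ ⊎ Any (S ≡_) L₂)                                       ∼⟨ IH₁ ⊎-⇔ IH₂ ⟩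
    (GraphletBetween k (In ∪ ⁅ v ⁆) V S ⊎ GraphletBetween k In (V - v) S) ∼⟨ ⇔-sym (graphlets-branch v) ⟩
    GraphletBetween k In V S                                              ∎
    where
    open EquationalReasoning {k = equivalence}
    IH₁ = Run⇒enumerates 1≤k run₁ (Admissible-∪⁅⁆ adm v∈N) S
    IH₂ = Run⇒enumerates 1≤k run₂ (Admissible-V-v adm v∈N) S
  Run⇒enumerates 1≤k (stuck ∣In∣≢k no-N) adm S =
    mk⇔ (λ ()) (λ b → ⊥-elim (no-graphlets-stuck ∣In∣≢k (Admissible.nonempty adm) no-N b))

theorem2 : ∀ {n} (G : Graph n) (k : ℕ) (In : Subset n) →
    1 ≤ k → Connected G → Nonempty In → ConnectedOn G In →
    Σ (List (Subset n)) (λ L → Run G k ⊤ In L) ×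
    (∀ L → Run G k ⊤ In L →
    ∀ S → (Any (S ≡_) L ⇔ (Graphlet G k S × In ⊆ S)))
theorem2 G k In 1≤k _ ne conn =
  Run-exists G k ⊤ In ,
  λ L run S → forget-⊆⊤ ⇔-∘ Run⇒enumerates G 1≤k run adm S
  where
  adm : Admissible G ⊤ In
  adm = record { In⊆V = λ _ → ∈⊤ ; nonempty = ne ; connected = conn }
  forget-⊆⊤ : ∀ {S} → GraphletBetween G k In ⊤ S ⇔ (Graphlet G k S × In ⊆ S)
  forget-⊆⊤ = mk⇔ (λ (g , In⊆S , _) → g , In⊆S) (λ (g , In⊆S) → g , In⊆S , λ _ → ∈⊤)
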